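{- Let $q=p^n$ with $p$ an odd prime, let $\alpha,\beta\in GF(q^2)$ with $\alpha\neq0$, $\beta=\overline{\beta}$, and $4N(\alpha)+(\overline{\beta}-\beta)^2$ a non-square in $GF(q)$. Then for every point $P\notin U_{\alpha,\beta}$ of $PG(2,q^2)$, the set $\tau_P(U_{\alpha,\beta})$ is either contained in a line or is an arc.
   Context: $GF(q^2)=\{a+\epsilon b: a,b\in GF(q)\}$ with $\epsilon^2=w\in GF(q)$, $\epsilon\notin GF(q)$. For $x\in GF(q^2)$ write $\overline{x}=x^q$, $N(x)=x\overline{x}$. Points of $PG(2,q^2)$ are written $[a,b,c]$ (homogeneous coordinates). $P_\infty=[0,1,0]$. The orthogonal-Buekenhout-Metz unital is $U_{\alpha,\beta}=\{[x,\alpha x^2+\beta N(x)+r,1]: x\in GF(q^2), r\in GF(q)\}\cup\{P_\infty\}$; every line meets it in $1$ point (tangent) or $q+1$ points (secant). For a point $P\notin U_{\alpha,\beta}$, the feet of $P$ are the $q+1$ points of contact with $U_{\alpha,\beta}$ of the tangent lines through $P$, and $\tau_P(U_{\alpha,\beta})$ denotes the set of feet of $P$. An arc is a set of points no three of which are collinear. -}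

module Defs where

open import Level using (0ℓ)
open import Algebra.Bundles using (CommutativeRing)
open import Data.Product using (Σ; ∃; ∃₂; _×_; _,_)
open import Data.Sum using (_⊎_)
open import Data.Nat using (ℕ)
open import Data.List using (List; length)
open import Data.List.Relation.Unary.Any using (Any)
open import Data.List.Relation.Unary.AllPairs using (AllPairs)
open import Relation.Nullary using (¬_)
open import Relation.Binary.Definitions using (Decidable)
open import Relation.Binary.PropositionalEquality using (_≡_)

record IsFiniteField (R : CommutativeRing 0ℓ 0ℓ) (q : ℕ) : Set where
  open CommutativeRing R
  field
    0≉1     : ¬ (0# ≈ 1#)
    inverse : ∀ x → ¬ (x ≈ 0#) → ∃ λ y → x * y ≈ 1#
    _≟F_    : Decidable _≈_
    elems   : List Carrier
    complete : ∀ x → Any (x ≈_) elems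
    distinct : AllPairs (λ a b → ¬ (a ≈ b)) elems
    card     : length elems ≡ q

-- The geometry of PG(2,q^2) over GF(q^2) = { a + εb }, ε² = w.
module Plane (R : CommutativeRing 0ℓ 0ℓ) (w : CommutativeRing.Carrier R) where
  open CommutativeRing R

  F : Set
  F = Carrier

  IsSquare : F → Set
  IsSquare x = ∃ λ y → y * y ≈ x

  K : Set
  K = F × F

  infix 4 _≈K_ _≈P_ _∼_
  infixl 6 _+K_ _-K_
  infixl 7 _*K_
  infix 8 -K_

  _≈K_ : K → K → Set
  (a , b) ≈K (c , d) = (a ≈ c) × (b ≈ d)

  embed : F → K
  embed a = (a , 0#)

  0K 1K : K
  0K = embed 0#
  1K = embed 1#

  _+K_ : K → K → K
  (a , b) +K (c , d) = (a + c , b + d)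

  -K_ : K → K
  -K (a , b) = (- a , - b)

  _-K_ : K → K → K
  x -K y = x +K (-K y)

  _*K_ : K → K → K
  (a , b) *K (c , d) = (a * c + w * (b * d) , a * d + b * c)

  -- conjugation x ↦ x^q, i.e. a + εb ↦ a - εb
  conj : K → K
  conj (a , b) = (a , - b)

  N : K → K
  N x = x *K conj x

  NonSquareInF : K → Set
  NonSquareInF (a , b) = (b ≈ 0#) × ¬ IsSquare a

  Pt : Set
  Pt = K × K × K

  _≈P_ : Pt → Pt → Set
  (x , y , z) ≈P (x' , y' , z') = (x ≈K x') × (y ≈K y') × (z ≈K z')

  NonZeroPt : Pt → Set
  NonZeroPt (x , y , z) = ¬ ((x ≈K 0K) × (y ≈K 0K) × (z ≈K 0K))

  scale : K → Pt → Pt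
  scale c (x , y , z) = (c *K x , c *K y , c *K z)

  _∼_ : Pt → Pt → Set
  P ∼ Q = ∃ λ c → ¬ (c ≈K 0K) × (P ≈P scale c Q)

  Incident : Pt → Pt → Set
  Incident (l , m , n) (x , y , z) = ((l *K x) +K (m *K y)) +K (n *K z) ≈K 0K

  det3 : Pt → Pt → Pt → K
  det3 (a1 , a2 , a3) (b1 , b2 , b3) (c1 , c2 , c3) =
    ((a1 *K ((b2 *K c3) -K (b3 *K c2)))
      -K (a2 *K ((b1 *K c3) -K (b3 *K c1))))
      +K (a3 *K ((b1 *K c2) -K (b2 *K c1)))

  Collinear : Pt → Pt → Pt → Set
  Collinear A B C = det3 A B C ≈K 0K

  P∞ : Pt
  P∞ = (0K , 1K , 0K)

  InU : K → K → Pt → Set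
  InU α β P =
    (P ∼ P∞) ⊎
    (∃₂ λ (x : K) (r : F) →
       P ∼ (x , ((α *K (x *K x)) +K (β *K N x)) +K embed r , 1K))

  IsTangentAt : (Pt → Set) → Pt → Pt → Set
  IsTangentAt U L T =
    U T × Incident L T ×
    (∀ Q → NonZeroPt Q → U Q → Incident L Q → Q ∼ T)

  IsFoot : (Pt → Set) → Pt → Pt → Set
  IsFoot U P T =
    NonZeroPt T × U T ×
    (∃ λ L → NonZeroPt L × Incident L P × IsTangentAt U L T)

  ContainedInLine : (Pt → Set) → Set
  ContainedInLine S =
    ∃ λ L → NonZeroPt L × (∀ T → NonZeroPt T → S T → Incident L T)

  IsArc : (Pt → Set) → Set
  IsArc S =
    ∀ A B C → NonZeroPt A → NonZeroPt B → NonZeroPt C →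
    S A → S B → S C →
    ¬ (A ∼ B) → ¬ (A ∼ C) → ¬ (B ∼ C) → ¬ Collinear A B C

  fourK : K
  fourK = embed ((1# + 1#) + (1# + 1#))

{-# OPTIONS --safe #-}
-- Put f(x) = αx² + βN(x). Since β ∈ GF(q), f(t + u) − f(t) − α(2tu + u²) lies in GF(q), so a
-- line [l, m, n] through a point (t, s, 1) of U_{α,β} meets U_{α,β} again unless m ≠ 0 and
-- l = −2αtm; similarly the only tangent at P∞ is z = 0. Eliminating l and n, a point
-- P = (p₁, p₂, p₃) on the tangent at (t, s, 1) satisfies p₃s = 2αp₃t² − 2αp₁t + p₂. If p₃ = 0
-- this is the line 2αp₁x = p₂z, which also contains P∞. If p₃ ≠ 0, P∞ is not a foot and the
-- feet lie on a parabola, where three points with distinct abscissae t span the determinant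
-- 2α·(Vandermonde of the t's) ≠ 0.
module Submission where

open import Defs
open import Level using (0ℓ; _⊔_)
open import Algebra.Bundles using (CommutativeRing)
open import Algebra.Solver.Ring.AlmostCommutativeRing using (fromCommutativeRing; _-Raw-AlmostCommutative⟶_)
open import Data.Empty using (⊥-elim)
open import Data.Integer as ℤ using (ℤ; +_; -[1+_])
import Data.Integer.Properties as ℤ
open import Data.Maybe using (Maybe; just; nothing)
open import Data.Nat as ℕ using (ℕ; zero; suc; _^_)
import Data.Nat.Properties as ℕ
open import Data.Nat.Primality using (Prime)
open import Data.Product using (∃; ∃₂; _×_; _,_; proj₁; proj₂)
open import Data.Sign as Sign using ()
open import Data.Sum using (_⊎_; inj₁; inj₂; [_,_])
open import Function using (_∘_; id)
open import Relation.Binary.Definitions using (Decidable)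
open import Relation.Binary.PropositionalEquality as ≡ using (_≢_)
import Relation.Binary.Reasoning.Setoid as SetoidReasoning
open import Relation.Nullary using (¬_; yes; no)
open import Relation.Nullary.Decidable using (_×-dec_; decidable-stable)

module IntegerRingSolver {c ℓ} (R : CommutativeRing c ℓ) where
  open CommutativeRing R
  open import Algebra.Properties.Ring ring
    using (-‿involutive; -0#≈0#; -‿distribˡ-*; -‿distribʳ-*; -‿+-comm)
  open import Algebra.Properties.Semiring.Mult.TCOptimised semiring
    using (×-homo-+; ×1-homo-*; 1+×) renaming (_×_ to _×ₙ_)
  open SetoidReasoning setoid

  -- The optimised ℕ-action makes con (+ 1) and con (+ 2) evaluate to 1# and 1# + 1#,
  -- so solver equations match goals stated with these constants.
  ι : ℕ → Carrier
  ι n = n ×ₙ 1#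

  ⟦_⟧ℤ : ℤ → Carrier
  ⟦ + n ⟧ℤ = ι n
  ⟦ -[1+ n ] ⟧ℤ = - ι (suc n)

  1+a-[1+b]≈a-b : ∀ a b → (1# + a) - (1# + b) ≈ a - b
  1+a-[1+b]≈a-b a b = begin
    (1# + a) - (1# + b)        ≈⟨ +-congˡ (-‿+-comm 1# b) ⟨
    (1# + a) + (- 1# - b)      ≈⟨ +-congʳ (+-comm 1# a) ⟩
    (a + 1#) + (- 1# - b)      ≈⟨ +-assoc a 1# _ ⟩
    a + (1# + (- 1# - b))      ≈⟨ +-congˡ (+-assoc 1# (- 1#) _) ⟨
    a + ((1# - 1#) - b)        ≈⟨ +-congˡ (+-congʳ (-‿inverseʳ 1#)) ⟩
    a + (0# - b)               ≈⟨ +-congˡ (+-identityˡ _) ⟩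
    a - b                      ∎

  ⊖-homo : ∀ m n → ⟦ m ℤ.⊖ n ⟧ℤ ≈ ι m - ι n
  ⊖-homo zero zero = sym (-‿inverseʳ 0#)
  ⊖-homo zero (suc n) = sym (+-identityˡ _)
  ⊖-homo (suc m) zero = sym (trans (+-congˡ -0#≈0#) (+-identityʳ _))
  ⊖-homo (suc m) (suc n) = begin
    ⟦ suc m ℤ.⊖ suc n ⟧ℤ       ≡⟨ ≡.cong ⟦_⟧ℤ (ℤ.[1+m]⊖[1+n]≡m⊖n m n) ⟩
    ⟦ m ℤ.⊖ n ⟧ℤ               ≈⟨ ⊖-homo m n ⟩
    ι m - ι n                  ≈⟨ 1+a-[1+b]≈a-b (ι m) (ι n) ⟨
    (1# + ι m) - (1# + ι n)    ≈⟨ +-cong (1+× m 1#) (-‿cong (1+× n 1#)) ⟨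
    ι (suc m) - ι (suc n)      ∎

  +-homo : ∀ i j → ⟦ i ℤ.+ j ⟧ℤ ≈ ⟦ i ⟧ℤ + ⟦ j ⟧ℤ
  +-homo (+ m) (+ n) = ×-homo-+ 1# m n
  +-homo (+ m) -[1+ n ] = ⊖-homo m (suc n)
  +-homo -[1+ m ] (+ n) = trans (⊖-homo n (suc m)) (+-comm _ _)
  +-homo -[1+ m ] -[1+ n ] = begin
    - ι (suc (suc (m ℕ.+ n)))      ≡⟨ ≡.cong (λ k → - ι (suc k)) (ℕ.+-suc m n) ⟨
    - ι (suc m ℕ.+ suc n)          ≈⟨ -‿cong (×-homo-+ 1# (suc m) (suc n)) ⟩
    - (ι (suc m) + ι (suc n))      ≈⟨ -‿+-comm _ _ ⟨
    - ι (suc m) - ι (suc n)        ∎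

  ◃-homo-pos : ∀ n → ⟦ Sign.+ ℤ.◃ n ⟧ℤ ≈ ι n
  ◃-homo-pos zero = refl
  ◃-homo-pos (suc n) = refl

  ◃-homo-neg : ∀ n → ⟦ Sign.- ℤ.◃ n ⟧ℤ ≈ - ι n
  ◃-homo-neg zero = sym -0#≈0#
  ◃-homo-neg (suc n) = refl

  *-homo : ∀ i j → ⟦ i ℤ.* j ⟧ℤ ≈ ⟦ i ⟧ℤ * ⟦ j ⟧ℤ
  *-homo (+ m) (+ n) = trans (◃-homo-pos (m ℕ.* n)) (×1-homo-* m n)
  *-homo (+ m) -[1+ n ] = begin
    ⟦ Sign.- ℤ.◃ (m ℕ.* suc n) ⟧ℤ  ≈⟨ ◃-homo-neg (m ℕ.* suc n) ⟩
    - ι (m ℕ.* suc n)              ≈⟨ -‿cong (×1-homo-* m (suc n)) ⟩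
    - (ι m * ι (suc n))            ≈⟨ -‿distribʳ-* _ _ ⟩
    ι m * - ι (suc n)              ∎
  *-homo -[1+ m ] (+ n) = begin
    ⟦ Sign.- ℤ.◃ (suc m ℕ.* n) ⟧ℤ  ≈⟨ ◃-homo-neg (suc m ℕ.* n) ⟩
    - ι (suc m ℕ.* n)              ≈⟨ -‿cong (×1-homo-* (suc m) n) ⟩
    - (ι (suc m) * ι n)            ≈⟨ -‿distribˡ-* _ _ ⟩
    - ι (suc m) * ι n              ∎
  *-homo -[1+ m ] -[1+ n ] = begin
    ⟦ Sign.+ ℤ.◃ (suc m ℕ.* suc n) ⟧ℤ  ≈⟨ ◃-homo-pos (suc m ℕ.* suc n) ⟩
    ι (suc m ℕ.* suc n)                ≈⟨ ×1-homo-* (suc m) (suc n) ⟩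
    ι (suc m) * ι (suc n)              ≈⟨ -‿involutive _ ⟨
    - - (ι (suc m) * ι (suc n))        ≈⟨ -‿cong (-‿distribˡ-* _ _) ⟩
    - (- ι (suc m) * ι (suc n))        ≈⟨ -‿distribʳ-* _ _ ⟩
    - ι (suc m) * - ι (suc n)          ∎

  -‿homo : ∀ i → ⟦ ℤ.- i ⟧ℤ ≈ - ⟦ i ⟧ℤ
  -‿homo (+ zero) = sym -0#≈0#
  -‿homo (+ suc n) = refl
  -‿homo -[1+ n ] = sym (-‿involutive _)

  ℤ⟶R : CommutativeRing.rawRing ℤ.+-*-commutativeRing -Raw-AlmostCommutative⟶ fromCommutativeRing R
  ℤ⟶R = record
    { ⟦_⟧ = ⟦_⟧ℤ ; +-homo = +-homo ; *-homo = *-homo ; -‿homo = -‿homo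
    ; 0-homo = refl ; 1-homo = refl }

  ℤ-weaklyDec : ∀ i j → Maybe (⟦ i ⟧ℤ ≈ ⟦ j ⟧ℤ)
  ℤ-weaklyDec i j with i ℤ.≟ j
  ... | yes ≡.refl = just refl
  ... | no _ = nothing

  open import Algebra.Solver.Ring (CommutativeRing.rawRing ℤ.+-*-commutativeRing)
    (fromCommutativeRing R) ℤ⟶R ℤ-weaklyDec public

record IsField {c ℓ} (R : CommutativeRing c ℓ) : Set (c ⊔ ℓ) where
  open CommutativeRing R
  field
    0≉1     : ¬ 0# ≈ 1#
    inverse : ∀ x → ¬ x ≈ 0# → ∃ λ y → x * y ≈ 1#

record IsDecField {c ℓ} (R : CommutativeRing c ℓ) : Set (c ⊔ ℓ) where
  open CommutativeRing R
  field
    isField : IsField R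
    _≟_     : Decidable _≈_

  open IsField isField public

module FieldProperties {c ℓ} (R : CommutativeRing c ℓ) (isField : IsField R) where
  open CommutativeRing R
  open IsField isField
  open SetoidReasoning setoid
  open IntegerRingSolver R using (solve; _:*_; _:=_)
  open import Algebra.Properties.Ring ring using (x[y-z]≈xy-xz; x≈y⇒x∙y⁻¹≈ε; x∙y⁻¹≈ε⇒x≈y)

  x≉0∧x*y≈0⇒y≈0 : ∀ {x y} → ¬ x ≈ 0# → x * y ≈ 0# → y ≈ 0#
  x≉0∧x*y≈0⇒y≈0 {x} {y} x≉0 xy≈0 with inverse x x≉0
  ... | x⁻¹ , xx⁻¹≈1 = begin
    y               ≈⟨ *-identityˡ y ⟨
    1# * y          ≈⟨ *-congʳ xx⁻¹≈1 ⟨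
    (x * x⁻¹) * y   ≈⟨ solve 3 (λ x x⁻¹ y → (x :* x⁻¹) :* y := x⁻¹ :* (x :* y)) refl x x⁻¹ y ⟩
    x⁻¹ * (x * y)   ≈⟨ *-congˡ xy≈0 ⟩
    x⁻¹ * 0#        ≈⟨ zeroʳ x⁻¹ ⟩
    0#              ∎

  x*y≉0 : ∀ {x y} → ¬ x ≈ 0# → ¬ y ≈ 0# → ¬ x * y ≈ 0#
  x*y≉0 x≉0 y≉0 xy≈0 = y≉0 (x≉0∧x*y≈0⇒y≈0 x≉0 xy≈0)

  *-cancelˡ-≉0 : ∀ {x y z} → ¬ x ≈ 0# → x * y ≈ x * z → y ≈ z
  *-cancelˡ-≉0 {x} {y} {z} x≉0 xy≈xz = x∙y⁻¹≈ε⇒x≈y y z (x≉0∧x*y≈0⇒y≈0 x≉0 (begin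
    x * (y - z)     ≈⟨ x[y-z]≈xy-xz x y z ⟩
    x * y - x * z   ≈⟨ x≈y⇒x∙y⁻¹≈ε xy≈xz ⟩
    0#              ∎))

  x*y≈1⇒y≉0 : ∀ {x y} → x * y ≈ 1# → ¬ y ≈ 0#
  x*y≈1⇒y≉0 {x} xy≈1 y≈0 = 0≉1 (trans (sym (zeroʳ x)) (trans (*-congˡ (sym y≈0)) xy≈1))

module QuadraticExtension (R : CommutativeRing 0ℓ 0ℓ) (w : CommutativeRing.Carrier R) where
  open CommutativeRing R
  open Plane R w
  open IntegerRingSolver R using (solve; _:+_; _:*_; _:-_; :-_; _:=_; con)
  open import Algebra.Properties.Ring ring using (-0#≈0#)

  K-commutativeRing : CommutativeRing 0ℓ 0ℓ
  K-commutativeRing = record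
    { Carrier = K ; _≈_ = _≈K_ ; _+_ = _+K_ ; _*_ = _*K_ ; -_ = -K_ ; 0# = 0K ; 1# = 1K
    ; isCommutativeRing = record
      { isRing = record
        { +-isAbelianGroup = record
          { isGroup = record
            { isMonoid = record
              { isSemigroup = record
                { isMagma = record
                  { isEquivalence = record
                    { refl = refl , refl
                    ; sym = λ (e , e′) → sym e , sym e′
                    ; trans = λ (e , e′) (f , f′) → trans e f , trans e′ f′ }
                  ; ∙-cong = λ (e , e′) (f , f′) → +-cong e f , +-cong e′ f′ }
                ; assoc = λ (a , b) (c , d) (e , f) → +-assoc a c e , +-assoc b d f }
              ; identity = (λ (a , b) → +-identityˡ a , +-identityˡ b)
                         , (λ (a , b) → +-identityʳ a , +-identityʳ b) }
            ; inverse = (λ (a , b) → -‿inverseˡ a , -‿inverseˡ b)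
                      , (λ (a , b) → -‿inverseʳ a , -‿inverseʳ b)
            ; ⁻¹-cong = λ (e , e′) → -‿cong e , -‿cong e′ }
          ; comm = λ (a , b) (c , d) → +-comm a c , +-comm b d }
        ; *-cong = λ (e , e′) (f , f′) →
            +-cong (*-cong e f) (*-congˡ (*-cong e′ f′)) , +-cong (*-cong e f′) (*-cong e′ f)
        ; *-assoc = λ (a , b) (c , d) (e , f) →
              solve 7 (λ w a b c d e f →
                (a :* c :+ w :* (b :* d)) :* e :+ w :* ((a :* d :+ b :* c) :* f)
                := a :* (c :* e :+ w :* (d :* f)) :+ w :* (b :* (c :* f :+ d :* e))) refl w a b c d e f
            , solve 7 (λ w a b c d e f →
                (a :* c :+ w :* (b :* d)) :* f :+ (a :* d :+ b :* c) :* e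
                := a :* (c :* f :+ d :* e) :+ b :* (c :* e :+ w :* (d :* f))) refl w a b c d e f
        ; *-identity =
              (λ (a , b) → trans (+-cong (*-identityˡ a) (trans (*-congˡ (zeroˡ b)) (zeroʳ w))) (+-identityʳ a)
                         , trans (+-cong (*-identityˡ b) (zeroˡ a)) (+-identityʳ b))
            , (λ (a , b) → trans (+-cong (*-identityʳ a) (trans (*-congˡ (zeroʳ b)) (zeroʳ w))) (+-identityʳ a)
                         , trans (+-cong (zeroʳ a) (*-identityʳ b)) (+-identityˡ b))
        ; distrib =
              (λ (a , b) (c , d) (e , f) →
                  solve 7 (λ w a b c d e f → a :* (c :+ e) :+ w :* (b :* (d :+ f))
                    := (a :* c :+ w :* (b :* d)) :+ (a :* e :+ w :* (b :* f))) refl w a b c d e f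
                , solve 6 (λ a b c d e f → a :* (d :+ f) :+ b :* (c :+ e)
                    := (a :* d :+ b :* c) :+ (a :* f :+ b :* e)) refl a b c d e f)
            , (λ (a , b) (c , d) (e , f) →
                  solve 7 (λ w a b c d e f → (c :+ e) :* a :+ w :* ((d :+ f) :* b)
                    := (c :* a :+ w :* (d :* b)) :+ (e :* a :+ w :* (f :* b))) refl w a b c d e f
                , solve 6 (λ a b c d e f → (c :+ e) :* b :+ (d :+ f) :* a
                    := (c :* b :+ d :* a) :+ (e :* b :+ f :* a)) refl a b c d e f)
        }
      ; *-comm = λ (a , b) (c , d) →
            solve 5 (λ w a b c d → a :* c :+ w :* (b :* d) := c :* a :+ w :* (d :* b)) refl w a b c d
          , solve 4 (λ a b c d → a :* d :+ b :* c := c :* b :+ d :* a) refl a b c d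
      }
    }

  -- A record rather than proj₂ x ≈ 0#, so that x is inferable from a proof of InF x.
  record InF (x : K) : Set where
    constructor inF
    field imaginary≈0 : proj₂ x ≈ 0#

  InF-embed : ∀ r → InF (embed r)
  InF-embed _ = inF refl

  InF⇒≈embed : ∀ {x} → InF x → x ≈K embed (proj₁ x)
  InF⇒≈embed (inF b≈0) = refl , b≈0

  InF-resp-≈K : ∀ {x y} → x ≈K y → InF x → InF y
  InF-resp-≈K (_ , e) (inF b≈0) = inF (trans (sym e) b≈0)

  InF-+ : ∀ {x y} → InF x → InF y → InF (x +K y)
  InF-+ (inF b≈0) (inF d≈0) = inF (trans (+-cong b≈0 d≈0) (+-identityʳ 0#))

  InF-neg : ∀ {x} → InF x → InF (-K x)
  InF-neg (inF b≈0) = inF (trans (-‿cong b≈0) -0#≈0#)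

  InF-* : ∀ {x y} → InF x → InF y → InF (x *K y)
  InF-* {a , _} {c , _} (inF b≈0) (inF d≈0) =
    inF (trans (+-cong (*-congˡ d≈0) (*-congʳ b≈0)) (trans (+-cong (zeroʳ a) (zeroˡ c)) (+-identityʳ 0#)))

  InF-N : ∀ x → InF (N x)
  InF-N (a , b) = inF (solve 2 (λ a b → a :* (:- b) :+ b :* a := con (+ 0)) refl a b)

  trace : K → K → K
  trace x y = x *K conj y +K y *K conj x

  InF-trace : ∀ x y → InF (trace x y)
  InF-trace (a , b) (c , d) = inF (
    solve 4 (λ a b c d → (a :* (:- d) :+ b :* c) :+ (c :* (:- b) :+ d :* a) := con (+ 0)) refl a b c d)

  N-+ : ∀ x y → N (x +K y) ≈K (N x +K N y) +K trace x y
  N-+ (a , b) (c , d) =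
      solve 5 (λ w a b c d →
        (a :+ c) :* (a :+ c) :+ w :* ((b :+ d) :* (:- (b :+ d)))
        := (a :* a :+ w :* (b :* (:- b)) :+ (c :* c :+ w :* (d :* (:- d))))
           :+ ((a :* c :+ w :* (b :* (:- d))) :+ (c :* a :+ w :* (d :* (:- b))))) refl w a b c d
    , solve 4 (λ a b c d →
        (a :+ c) :* (:- (b :+ d)) :+ (b :+ d) :* (a :+ c)
        := (a :* (:- b) :+ b :* a :+ (c :* (:- d) :+ d :* c))
           :+ ((a :* (:- d) :+ b :* c) :+ (c :* (:- b) :+ d :* a))) refl a b c d

module QuadraticExtensionField (R : CommutativeRing 0ℓ 0ℓ) (𝔽 : IsDecField R)
    (w : CommutativeRing.Carrier R) (w-nonsquare : ¬ Plane.IsSquare R w w) where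
  open CommutativeRing R
  open IsDecField 𝔽
  open Plane R w
  open QuadraticExtension R w
  open FieldProperties R isField
  open IntegerRingSolver R using (solve; _:+_; _:*_; _:-_; :-_; _:=_; con)
  open import Algebra.Properties.Ring ring using (x∙y⁻¹≈ε⇒x≈y)
  open SetoidReasoning setoid

  _≟K_ : Decidable _≈K_
  (a , b) ≟K (c , d) = (a ≟ c) ×-dec (b ≟ d)

  K-0≉1 : ¬ 0K ≈K 1K
  K-0≉1 (0≈1 , _) = 0≉1 0≈1

  a*a≈w*b*b⇒≈0 : ∀ {a b} → a * a ≈ w * (b * b) → (a , b) ≈K 0K
  a*a≈w*b*b⇒≈0 {a} {b} a*a≈w*b*b with b ≟ 0#
  ... | yes b≈0 = a≈0 , b≈0
    where
    a≈0 : a ≈ 0#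
    a≈0 = decidable-stable (a ≟ 0#) λ a≉0 → x*y≉0 a≉0 a≉0 (begin
      a * a        ≈⟨ a*a≈w*b*b ⟩
      w * (b * b)  ≈⟨ *-congˡ (*-congʳ b≈0) ⟩
      w * (0# * b) ≈⟨ solve 2 (λ w b → w :* (con (+ 0) :* b) := con (+ 0)) refl w b ⟩
      0#           ∎)
  ... | no b≉0 with inverse b b≉0
  ...   | b⁻¹ , bb⁻¹≈1 = ⊥-elim (w-nonsquare (a * b⁻¹ , (begin
    (a * b⁻¹) * (a * b⁻¹)       ≈⟨ solve 2 (λ a b⁻¹ → (a :* b⁻¹) :* (a :* b⁻¹) := (a :* a) :* (b⁻¹ :* b⁻¹))
                                     refl a b⁻¹ ⟩
    (a * a) * (b⁻¹ * b⁻¹)       ≈⟨ *-congʳ a*a≈w*b*b ⟩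
    (w * (b * b)) * (b⁻¹ * b⁻¹) ≈⟨ solve 3 (λ w b b⁻¹ → (w :* (b :* b)) :* (b⁻¹ :* b⁻¹)
                                                      := w :* ((b :* b⁻¹) :* (b :* b⁻¹))) refl w b b⁻¹ ⟩
    w * ((b * b⁻¹) * (b * b⁻¹)) ≈⟨ *-congˡ (*-cong bb⁻¹≈1 bb⁻¹≈1) ⟩
    w * (1# * 1#)               ≈⟨ *-congˡ (*-identityˡ 1#) ⟩
    w * 1#                      ≈⟨ *-identityʳ w ⟩
    w                           ∎)))

  norm≉0 : ∀ {a b} → ¬ (a , b) ≈K 0K → ¬ a * a + w * (b * - b) ≈ 0#
  norm≉0 {a} {b} x≉0 norm≈0 = x≉0 (a*a≈w*b*b⇒≈0 (x∙y⁻¹≈ε⇒x≈y _ _ (begin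
    a * a - w * (b * b)   ≈⟨ solve 3 (λ a b w → a :* a :- w :* (b :* b) := a :* a :+ w :* (b :* (:- b)))
                               refl a b w ⟩
    a * a + w * (b * - b) ≈⟨ norm≈0 ⟩
    0#                    ∎)))

  K-inverse : ∀ x → ¬ x ≈K 0K → ∃ λ y → x *K y ≈K 1K
  K-inverse (a , b) x≉0 with inverse _ (norm≉0 x≉0)
  ... | ν , norm*ν≈1 = (a * ν , - b * ν) , e₁ , e₂
    where
    e₁ : a * (a * ν) + w * (b * (- b * ν)) ≈ 1#
    e₁ = trans (solve 4 (λ a b w ν → a :* (a :* ν) :+ w :* (b :* (:- b :* ν))
                                    := (a :* a :+ w :* (b :* (:- b))) :* ν) refl a b w ν)
               norm*ν≈1
    e₂ : a * (- b * ν) + b * (a * ν) ≈ 0#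
    e₂ = solve 3 (λ a b ν → a :* (:- b :* ν) :+ b :* (a :* ν) := con (+ 0)) refl a b ν

  K-isField : IsField K-commutativeRing
  K-isField = record { 0≉1 = K-0≉1 ; inverse = K-inverse }

  conj-fixed⇒InF : ¬ 1# + 1# ≈ 0# → ∀ {β} → β ≈K conj β → InF β
  conj-fixed⇒InF 2≉0 {a , b} (_ , b≈-b) = inF (x≉0∧x*y≈0⇒y≈0 2≉0 (begin
    (1# + 1#) * b ≈⟨ solve 1 (λ b → con (+ 2) :* b := b :+ b) refl b ⟩
    b + b         ≈⟨ +-congˡ b≈-b ⟩
    b - b         ≈⟨ -‿inverseʳ b ⟩
    0#            ∎))

  discriminant-nonsquare⇒2≉0 : ∀ {α β} → β ≈K conj β →
    NonSquareInF ((fourK *K N α) +K ((conj β -K β) *K (conj β -K β))) → ¬ 1# + 1# ≈ 0#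
  discriminant-nonsquare⇒2≉0 {α} {β@(a , b)} (_ , b≈-b) (_ , nonsquare) 2≈0 =
    nonsquare (0# , trans (zeroˡ 0#) (sym (proj₁ discriminant≈0)))
    where
    module K = CommutativeRing K-commutativeRing
    4≈0 : fourK ≈K 0K
    4≈0 = trans (+-cong 2≈0 2≈0) (+-identityʳ 0#) , refl
    β̄-β≈0 : conj β -K β ≈K 0K
    β̄-β≈0 = -‿inverseʳ a , trans (+-congʳ (sym b≈-b)) (-‿inverseʳ b)
    discriminant≈0 : (fourK *K N α) +K ((conj β -K β) *K (conj β -K β)) ≈K 0K
    discriminant≈0 = K.trans (K.+-cong (K.*-congʳ 4≈0) (K.*-congʳ β̄-β≈0))
                             (K.trans (K.+-cong (K.zeroˡ (N α)) (K.zeroˡ _)) (K.+-identityʳ 0K))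

module ProjectivePlane (R : CommutativeRing 0ℓ 0ℓ) (𝔽 : IsDecField R)
    (w : CommutativeRing.Carrier R) (w-nonsquare : ¬ Plane.IsSquare R w w) where
  open Plane R w
  open QuadraticExtension R w
  open QuadraticExtensionField R 𝔽 w w-nonsquare using (K-inverse; K-0≉1; K-isField; _≟K_)
  open CommutativeRing K-commutativeRing
  open FieldProperties K-commutativeRing K-isField
  open IntegerRingSolver K-commutativeRing using (solve; _:+_; _:*_; _:-_; :-_; _:=_; con)
  open import Algebra.Properties.Ring ring
    using (+-identityʳ-unique; x≈y⇒x∙y⁻¹≈ε; x∙y⁻¹≈ε⇒x≈y; -‿injective; -0#≈0#)
  open SetoidReasoning setoid

  K-1≉0 : ¬ 1K ≈K 0K
  K-1≉0 = K-0≉1 ∘ sym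

  dot : Pt → Pt → K
  dot (l , m , n) (x , y , z) = ((l *K x) +K (m *K y)) +K (n *K z)

  dot-scale : ∀ L c X → dot L (scale c X) ≈K c *K dot L X
  dot-scale (l , m , n) c (x , y , z) =
    solve 7 (λ l m n c x y z → l :* (c :* x) :+ m :* (c :* y) :+ n :* (c :* z)
                               := c :* (l :* x :+ m :* y :+ n :* z)) refl l m n c x y z

  dot-cong : ∀ L {X Y} → X ≈P Y → dot L X ≈K dot L Y
  dot-cong L (e₁ , e₂ , e₃) = +-cong (+-cong (*-congˡ e₁) (*-congˡ e₂)) (*-congˡ e₃)

  ≈P⇒∼ : ∀ {X Y} → X ≈P Y → X ∼ Y
  ≈P⇒∼ (e₁ , e₂ , e₃) = 1K , K-1≉0 , (by-1 e₁ , by-1 e₂ , by-1 e₃)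
    where
    by-1 : ∀ {x y} → x ≈ y → x ≈ 1K *K y
    by-1 x≈y = trans x≈y (sym (*-identityˡ _))

  ∼-sym : ∀ {X Y} → X ∼ Y → Y ∼ X
  ∼-sym (c , c≉0 , (e₁ , e₂ , e₃)) = c⁻¹ , x*y≈1⇒y≉0 cc⁻¹≈1 , (unscale e₁ , unscale e₂ , unscale e₃)
    where
    c-inverse : ∃ λ c⁻¹ → c *K c⁻¹ ≈K 1K
    c-inverse = K-inverse c c≉0
    c⁻¹ : K
    c⁻¹ = proj₁ c-inverse
    cc⁻¹≈1 : c *K c⁻¹ ≈K 1K
    cc⁻¹≈1 = proj₂ c-inverse
    unscale : ∀ {x y} → x ≈ c *K y → y ≈ c⁻¹ *K x
    unscale {x} {y} x≈cy = begin
      y                 ≈⟨ *-identityˡ y ⟨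
      1K *K y           ≈⟨ *-congʳ cc⁻¹≈1 ⟨
      (c *K c⁻¹) *K y   ≈⟨ *-congʳ (*-comm c c⁻¹) ⟩
      (c⁻¹ *K c) *K y   ≈⟨ *-assoc c⁻¹ c y ⟩
      c⁻¹ *K (c *K y)   ≈⟨ *-congˡ x≈cy ⟨
      c⁻¹ *K x          ∎

  ∼-trans : ∀ {X Y Z} → X ∼ Y → Y ∼ Z → X ∼ Z
  ∼-trans (c , c≉0 , (e₁ , e₂ , e₃)) (d , d≉0 , (f₁ , f₂ , f₃)) =
    c *K d , x*y≉0 c≉0 d≉0 , (compose e₁ f₁ , compose e₂ f₂ , compose e₃ f₃)
    where
    compose : ∀ {x y z} → x ≈ c *K y → y ≈ d *K z → x ≈ (c *K d) *K z
    compose x≈cy y≈dz = trans x≈cy (trans (*-congˡ y≈dz) (sym (*-assoc c d _)))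

  Incident-resp-∼ : ∀ L {X Y} → X ∼ Y → Incident L X → Incident L Y
  Incident-resp-∼ L {X} {Y} (c , c≉0 , X≈cY) L∋X = x≉0∧x*y≈0⇒y≈0 c≉0 (begin
    c *K dot L Y        ≈⟨ dot-scale L c Y ⟨
    dot L (scale c Y)   ≈⟨ dot-cong L X≈cY ⟨
    dot L X             ≈⟨ L∋X ⟩
    0K                  ∎)

  affine-∼⇒≈ : ∀ {x y x′ y′} → (x , y , 1K) ∼ (x′ , y′ , 1K) → x ≈K x′ × y ≈K y′
  affine-∼⇒≈ (c , _ , (e₁ , e₂ , 1≈c1)) = by-c≈1 e₁ , by-c≈1 e₂
    where
    c≈1 : c ≈ 1K
    c≈1 = sym (trans 1≈c1 (*-identityʳ c))
    by-c≈1 : ∀ {u v} → u ≈ c *K v → u ≈ v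
    by-c≈1 u≈cv = trans u≈cv (trans (*-congʳ c≈1) (*-identityˡ _))

  affine≢0 : ∀ {x y} → NonZeroPt (x , y , 1K)
  affine≢0 (_ , _ , 1≈0) = K-1≉0 1≈0

  affine≁P∞ : ∀ {x y} → ¬ (x , y , 1K) ∼ P∞
  affine≁P∞ (c , _ , (_ , _ , 1≈c0)) = K-1≉0 (trans 1≈c0 (zeroʳ c))

  det3-cong : ∀ {A A′ B B′ C C′} → A ≈P A′ → B ≈P B′ → C ≈P C′ → det3 A B C ≈K det3 A′ B′ C′
  det3-cong (a₁ , a₂ , a₃) (b₁ , b₂ , b₃) (c₁ , c₂ , c₃) =
    +-cong (minor (*-cong a₁ (minor (*-cong b₂ c₃) (*-cong b₃ c₂)))
                  (*-cong a₂ (minor (*-cong b₁ c₃) (*-cong b₃ c₁))))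
           (*-cong a₃ (minor (*-cong b₁ c₂) (*-cong b₂ c₁)))
    where
    minor : ∀ {x x′ y y′} → x ≈ x′ → y ≈ y′ → x -K y ≈ x′ -K y′
    minor x≈x′ y≈y′ = +-cong x≈x′ (-‿cong y≈y′)

  det3-scale : ∀ a b c A B C → det3 (scale a A) (scale b B) (scale c C) ≈K ((a *K b) *K c) *K det3 A B C
  det3-scale a b c (a₁ , a₂ , a₃) (b₁ , b₂ , b₃) (c₁ , c₂ , c₃) =
    solve 12 (λ a b c a₁ a₂ a₃ b₁ b₂ b₃ c₁ c₂ c₃ →
      ((a :* a₁) :* ((b :* b₂) :* (c :* c₃) :- (b :* b₃) :* (c :* c₂))
        :- (a :* a₂) :* ((b :* b₁) :* (c :* c₃) :- (b :* b₃) :* (c :* c₁)))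
        :+ (a :* a₃) :* ((b :* b₁) :* (c :* c₂) :- (b :* b₂) :* (c :* c₁))
      := ((a :* b) :* c) :* ((a₁ :* (b₂ :* c₃ :- b₃ :* c₂) :- a₂ :* (b₁ :* c₃ :- b₃ :* c₁))
                             :+ a₃ :* (b₁ :* c₂ :- b₂ :* c₁)))
      refl a b c a₁ a₂ a₃ b₁ b₂ b₃ c₁ c₂ c₃

  Collinear-resp-∼ : ∀ {A B C A′ B′ C′} → A ∼ A′ → B ∼ B′ → C ∼ C′ →
    Collinear A B C → Collinear A′ B′ C′
  Collinear-resp-∼ {A′ = A′} {B′} {C′} (a , a≉0 , A≈aA′) (b , b≉0 , B≈bB′) (c , c≉0 , C≈cC′) ABC =
    x≉0∧x*y≈0⇒y≈0 (x*y≉0 (x*y≉0 a≉0 b≉0) c≉0) (begin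
      ((a *K b) *K c) *K det3 A′ B′ C′                  ≈⟨ det3-scale a b c A′ B′ C′ ⟨
      det3 (scale a A′) (scale b B′) (scale c C′)      ≈⟨ det3-cong A≈aA′ B≈bB′ C≈cC′ ⟨
      det3 _ _ _                                        ≈⟨ ABC ⟩
      0K                                                ∎)

  IsTangentAt-resp-∼ : ∀ {U : Pt → Set} {L T A} → T ∼ A → U A → IsTangentAt U L T → IsTangentAt U L A
  IsTangentAt-resp-∼ {L = L} T∼A UA (_ , L∋T , touches-only-T) =
    UA , Incident-resp-∼ L T∼A L∋T , λ Q Q≢0 UQ L∋Q → ∼-trans (touches-only-T Q Q≢0 UQ L∋Q) T∼A

  IsArc-⊆ : ∀ {S S′ : Pt → Set} → (∀ {T} → S T → S′ T) → IsArc S′ → IsArc S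
  IsArc-⊆ S⊆S′ arc A B C A≢0 B≢0 C≢0 SA SB SC =
    arc A B C A≢0 B≢0 C≢0 (S⊆S′ SA) (S⊆S′ SB) (S⊆S′ SC)

  quadratic : K → K → K → K → K
  quadratic a b d t = (a *K (t *K t) +K b *K t) +K d

  AffineParabola : K → K → K → K → Pt → Set
  AffineParabola c a b d T = ∃₂ λ t s → T ∼ (t , s , 1K) × c *K s ≈K quadratic a b d t

  vandermonde : K → K → K → K
  vandermonde x y z = ((x -K y) *K (y -K z)) *K (z -K x)

  parabola-det : ∀ {c a b d ta sa tb sb tc sc} →
    c *K sa ≈K quadratic a b d ta → c *K sb ≈K quadratic a b d tb → c *K sc ≈K quadratic a b d tc →
    c *K det3 (ta , sa , 1K) (tb , sb , 1K) (tc , sc , 1K) ≈K a *K vandermonde ta tb tc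
  parabola-det {c} {a} {b} {d} {ta} {sa} {tb} {sb} {tc} {sc} A∈ B∈ C∈ = begin
    c *K det3 (ta , sa , 1K) (tb , sb , 1K) (tc , sc , 1K)
      ≈⟨ solve 10 (λ c a b d ta sa tb sb tc sc →
           let q = λ t → (a :* (t :* t) :+ b :* t) :+ d in
           c :* ((ta :* (sb :* con (+ 1) :- con (+ 1) :* sc) :- sa :* (tb :* con (+ 1) :- con (+ 1) :* tc))
                 :+ con (+ 1) :* (tb :* sc :- sb :* tc))
           := (((tc :- tb) :* (c :* sa :- q ta) :+ (ta :- tc) :* (c :* sb :- q tb))
                :+ (tb :- ta) :* (c :* sc :- q tc))
              :+ a :* (((ta :- tb) :* (tb :- tc)) :* (tc :- ta)))
           refl c a b d ta sa tb sb tc sc ⟩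
    (((tc -K tb) *K (c *K sa -K q ta) +K (ta -K tc) *K (c *K sb -K q tb))
      +K (tb -K ta) *K (c *K sc -K q tc)) +K a *K vandermonde ta tb tc
      ≈⟨ +-congʳ (+-cong (+-cong (*-congˡ (x≈y⇒x∙y⁻¹≈ε A∈)) (*-congˡ (x≈y⇒x∙y⁻¹≈ε B∈)))
                         (*-congˡ (x≈y⇒x∙y⁻¹≈ε C∈))) ⟩
    (((tc -K tb) *K 0K +K (ta -K tc) *K 0K) +K (tb -K ta) *K 0K) +K a *K vandermonde ta tb tc
      ≈⟨ solve 4 (λ x y z v → ((x :* con (+ 0) :+ y :* con (+ 0)) :+ z :* con (+ 0)) :+ v := v)
           refl (tc -K tb) (ta -K tc) (tb -K ta) (a *K vandermonde ta tb tc) ⟩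
    a *K vandermonde ta tb tc
      ∎
    where
    q : K → K
    q = quadratic a b d

  quadratic-cong : ∀ a b d {t t′} → t ≈K t′ → quadratic a b d t ≈K quadratic a b d t′
  quadratic-cong a b d t≈t′ = +-congʳ (+-cong (*-congˡ (*-cong t≈t′ t≈t′)) (*-congˡ t≈t′))

  parabola-abscissa-injective : ∀ {c a b d T T′ t s t′ s′} → ¬ c ≈K 0K →
    T ∼ (t , s , 1K) → c *K s ≈K quadratic a b d t →
    T′ ∼ (t′ , s′ , 1K) → c *K s′ ≈K quadratic a b d t′ →
    t ≈K t′ → T ∼ T′
  parabola-abscissa-injective {a = a} {b} {d} {s = s} {s′ = s′} c≉0 T∼ T∈ T′∼ T′∈ t≈t′ =
    ∼-trans T∼ (∼-trans (≈P⇒∼ (t≈t′ , s≈s′ , refl)) (∼-sym T′∼))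
    where
    s≈s′ : s ≈K s′
    s≈s′ = *-cancelˡ-≉0 c≉0 (trans T∈ (trans (quadratic-cong a b d t≈t′) (sym T′∈)))

  parabola-isArc : ∀ {c a b d} → ¬ c ≈K 0K → ¬ a ≈K 0K → IsArc (AffineParabola c a b d)
  parabola-isArc {c} {a} {b} {d} c≉0 a≉0 A B C _ _ _
      (ta , sa , A∼ , A∈) (tb , sb , B∼ , B∈) (tc , sc , C∼ , C∈) A≁B A≁C B≁C ABC =
    x*y≉0 (x*y≉0 (apart A∼ A∈ B∼ B∈ A≁B) (apart B∼ B∈ C∼ C∈ B≁C)) (apart C∼ C∈ A∼ A∈ (A≁C ∘ ∼-sym))
      (x≉0∧x*y≈0⇒y≈0 a≉0 (begin
        a *K vandermonde ta tb tc                                ≈⟨ parabola-det A∈ B∈ C∈ ⟨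
        c *K det3 (ta , sa , 1K) (tb , sb , 1K) (tc , sc , 1K)   ≈⟨ *-congˡ (Collinear-resp-∼ A∼ B∼ C∼ ABC) ⟩
        c *K 0K                                                  ≈⟨ zeroʳ c ⟩
        0K                                                       ∎))
    where
    apart : ∀ {T T′ t s t′ s′} →
      T ∼ (t , s , 1K) → c *K s ≈K quadratic a b d t →
      T′ ∼ (t′ , s′ , 1K) → c *K s′ ≈K quadratic a b d t′ →
      ¬ T ∼ T′ → ¬ t -K t′ ≈K 0K
    apart T∼ T∈ T′∼ T′∈ T≁T′ =
      T≁T′ ∘ parabola-abscissa-injective c≉0 T∼ T∈ T′∼ T′∈ ∘ x∙y⁻¹≈ε⇒x≈y _ _

  module BuekenhoutMetz (α β : K) (α≉0 : ¬ α ≈K 0K) (β∈F : InF β) (2≉0 : ¬ 1K +K 1K ≈K 0K) where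

    U : Pt → Set
    U = InU α β

    Foot : Pt → Pt → Set
    Foot = IsFoot U

    f : K → K
    f x = (α *K (x *K x)) +K (β *K N x)

    2α : K
    2α = (1K +K 1K) *K α

    f-shift : ∀ t u → f (t +K u) ≈K (f t +K α *K ((1K +K 1K) *K t *K u +K u *K u)) +K β *K (N u +K trace t u)
    f-shift t u = begin
      f (t +K u)
        ≈⟨ +-congˡ (*-congˡ (N-+ t u)) ⟩
      α *K ((t +K u) *K (t +K u)) +K β *K ((N t +K N u) +K trace t u)
        ≈⟨ solve 7 (λ α β t u Nt Nu T →
             α :* ((t :+ u) :* (t :+ u)) :+ β :* ((Nt :+ Nu) :+ T)
             := (α :* (t :* t) :+ β :* Nt :+ α :* (con (+ 2) :* t :* u :+ u :* u)) :+ β :* (Nu :+ T))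
             refl α β t u (N t) (N u) (trace t u) ⟩
      (f t +K α *K ((1K +K 1K) *K t *K u +K u *K u)) +K β *K (N u +K trace t u)
        ∎

    affine-∈U : ∀ {x y} → InF (y -K f x) → U (x , y , 1K)
    affine-∈U {x} {y} y-fx∈F = inj₂ (x , proj₁ (y -K f x) , ≈P⇒∼ (refl , y≈fx+r , refl))
      where
      y≈fx+r : y ≈K f x +K embed (proj₁ (y -K f x))
      y≈fx+r = trans (solve 2 (λ y fx → y := fx :+ (y :- fx)) refl y (f x)) (+-congˡ (InF⇒≈embed y-fx∈F))

    shift-∈U : ∀ {t s u v} → InF (s -K f t) → v ≈K α *K ((1K +K 1K) *K t *K u +K u *K u) →
      U (t +K u , s +K v , 1K)
    shift-∈U {t} {s} {u} {v} s-ft∈F v≈ = affine-∈U (InF-resp-≈K (sym shifted) (InF-+ s-ft∈F β-part∈F))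
      where
      β-part∈F : InF (-K (β *K (N u +K trace t u)))
      β-part∈F = InF-neg (InF-* β∈F (InF-+ (InF-N u) (InF-trace t u)))
      shifted : (s +K v) -K f (t +K u) ≈K (s -K f t) +K -K (β *K (N u +K trace t u))
      shifted = begin
        (s +K v) -K f (t +K u)
          ≈⟨ +-cong (+-congˡ v≈) (-‿cong (f-shift t u)) ⟩
        (s +K Δ) -K ((f t +K Δ) +K β *K (N u +K trace t u))
          ≈⟨ solve 4 (λ s Δ ft B → (s :+ Δ) :- ((ft :+ Δ) :+ B) := (s :- ft) :+ (:- B))
               refl s Δ (f t) (β *K (N u +K trace t u)) ⟩
        (s -K f t) +K -K (β *K (N u +K trace t u))
          ∎
        where
        Δ : K
        Δ = α *K ((1K +K 1K) *K t *K u +K u *K u)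

    tangent-m≉0 : ∀ {l m n t s} → InF (s -K f t) → IsTangentAt U (l , m , n) (t , s , 1K) → ¬ m ≈K 0K
    tangent-m≉0 {l} {m} {n} {t} {s} s-ft∈F (_ , L∋A , touches-only-A) m≈0 =
      K-1≉0 (+-identityʳ-unique s 1K (proj₂ (affine-∼⇒≈ (touches-only-A _ affine≢0 UQ L∋Q))))
      where
      UQ : U (t , s +K 1K , 1K)
      UQ = affine-∈U (InF-resp-≈K (solve 3 (λ s ft o → (s :- ft) :+ o := (s :+ o) :- ft) refl s (f t) 1K)
                                  (InF-+ s-ft∈F (InF-embed _)))
      L∋Q : Incident (l , m , n) (t , s +K 1K , 1K)
      L∋Q = begin
        l *K t +K m *K (s +K 1K) +K n *K 1K   ≈⟨ solve 5 (λ l m n t s → l :* t :+ m :* (s :+ con (+ 1)) :+ n :* con (+ 1)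
                                                  := (l :* t :+ m :* s :+ n :* con (+ 1)) :+ m) refl l m n t s ⟩
        dot (l , m , n) (t , s , 1K) +K m     ≈⟨ +-cong L∋A m≈0 ⟩
        0K +K 0K                              ≈⟨ +-identityʳ 0K ⟩
        0K                                    ∎

    tangent-slope : ∀ {l m n t s} → InF (s -K f t) → IsTangentAt U (l , m , n) (t , s , 1K) →
      l +K 2α *K t *K m ≈K 0K
    tangent-slope {l} {m} {n} {t} {s} s-ft∈F tangent@(_ , L∋A , touches-only-A) =
      decidable-stable (D ≟K 0K) λ D≉0 → x*y≉0 (x*y≉0 D≉0 (x*y≈1⇒y≉0 kk⁻¹≈1)) m≉0 μm≈0
      where
      -- Otherwise L meets U again at (t, s, 1) + μ·(−m, l, 0), where μ = D/(αm²).
      D : K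
      D = l +K 2α *K t *K m
      m≉0 : ¬ m ≈K 0K
      m≉0 = tangent-m≉0 s-ft∈F tangent
      k : K
      k = α *K (m *K m)
      k-inverse : ∃ λ k⁻¹ → k *K k⁻¹ ≈K 1K
      k-inverse = K-inverse k (x*y≉0 α≉0 (x*y≉0 m≉0 m≉0))
      k⁻¹ : K
      k⁻¹ = proj₁ k-inverse
      kk⁻¹≈1 : k *K k⁻¹ ≈K 1K
      kk⁻¹≈1 = proj₂ k-inverse
      μ : K
      μ = D *K k⁻¹

      μk≈D : μ *K k ≈K D
      μk≈D = begin
        (D *K k⁻¹) *K k   ≈⟨ *-assoc D k⁻¹ k ⟩
        D *K (k⁻¹ *K k)   ≈⟨ *-congˡ (trans (*-comm k⁻¹ k) kk⁻¹≈1) ⟩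
        D *K 1K           ≈⟨ *-identityʳ D ⟩
        D                 ∎

      v≈α[2tu+u²] : μ *K l ≈K α *K ((1K +K 1K) *K t *K (-K (μ *K m)) +K (-K (μ *K m)) *K (-K (μ *K m)))
      v≈α[2tu+u²] = x∙y⁻¹≈ε⇒x≈y _ _ (begin
        μ *K l -K α *K ((1K +K 1K) *K t *K (-K (μ *K m)) +K (-K (μ *K m)) *K (-K (μ *K m)))
          ≈⟨ solve 5 (λ μ l m t α →
               μ :* l :- α :* (con (+ 2) :* t :* (:- (μ :* m)) :+ (:- (μ :* m)) :* (:- (μ :* m)))
               := μ :* ((l :+ con (+ 2) :* α :* t :* m) :- μ :* (α :* (m :* m)))) refl μ l m t α ⟩
        μ *K (D -K μ *K k)   ≈⟨ *-congˡ (x≈y⇒x∙y⁻¹≈ε (sym μk≈D)) ⟩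
        μ *K 0K              ≈⟨ zeroʳ μ ⟩
        0K                   ∎)

      L∋Q : Incident (l , m , n) (t +K -K (μ *K m) , s +K μ *K l , 1K)
      L∋Q = begin
        l *K (t -K μ *K m) +K m *K (s +K μ *K l) +K n *K 1K
          ≈⟨ solve 6 (λ l m n t s μ → l :* (t :- μ :* m) :+ m :* (s :+ μ :* l) :+ n :* con (+ 1)
                                     := l :* t :+ m :* s :+ n :* con (+ 1)) refl l m n t s μ ⟩
        dot (l , m , n) (t , s , 1K)
          ≈⟨ L∋A ⟩
        0K ∎

      μm≈0 : μ *K m ≈K 0K
      μm≈0 = -‿injective (trans (+-identityʳ-unique t _ (proj₁ (affine-∼⇒≈ Q∼A))) (sym -0#≈0#))
        where
        Q∼A : (t +K -K (μ *K m) , s +K μ *K l , 1K) ∼ (t , s , 1K)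
        Q∼A = touches-only-A _ affine≢0 (shift-∈U s-ft∈F v≈α[2tu+u²]) L∋Q

    graph⊆U : ∀ x → U (x , f x , 1K)
    graph⊆U x = affine-∈U (InF-resp-≈K (sym (-‿inverseʳ (f x))) (InF-embed _))

    tangent-at-P∞ : ∀ {l m n} → IsTangentAt U (l , m , n) P∞ → l ≈K 0K × m ≈K 0K
    tangent-at-P∞ {l} {m} {n} (_ , L∋P∞ , touches-only-P∞) = l≈0 , m≈0
      where
      m≈0 : m ≈K 0K
      m≈0 = trans (solve 3 (λ l m n → m := l :* con (+ 0) :+ m :* con (+ 1) :+ n :* con (+ 0)) refl l m n) L∋P∞

      L∋graph : ∀ {l⁻¹} → l *K l⁻¹ ≈K 1K → Incident (l , m , n) (-K (n *K l⁻¹) , f (-K (n *K l⁻¹)) , 1K)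
      L∋graph {l⁻¹} ll⁻¹≈1 = begin
        l *K x +K m *K f x +K n *K 1K
          ≈⟨ solve 5 (λ l m n l⁻¹ fx → l :* (:- (n :* l⁻¹)) :+ m :* fx :+ n :* con (+ 1)
                                     := n :* (con (+ 1) :- l :* l⁻¹) :+ m :* fx) refl l m n l⁻¹ (f x) ⟩
        n *K (1K -K l *K l⁻¹) +K m *K f x
          ≈⟨ +-cong (*-congˡ (x≈y⇒x∙y⁻¹≈ε (sym ll⁻¹≈1))) (*-congʳ m≈0) ⟩
        n *K 0K +K 0K *K f x
          ≈⟨ solve 2 (λ n fx → n :* con (+ 0) :+ con (+ 0) :* fx := con (+ 0)) refl n (f x) ⟩
        0K ∎
        where
        x : K
        x = -K (n *K l⁻¹)

      l≈0 : l ≈K 0K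
      l≈0 = decidable-stable (l ≟K 0K) λ l≉0 →
        affine≁P∞ (touches-only-P∞ _ affine≢0 (graph⊆U _) (L∋graph (proj₂ (K-inverse l l≉0))))

    footParabola : Pt → Pt → Set
    footParabola (p₁ , p₂ , p₃) = AffineParabola p₃ (2α *K p₃) (-K (2α *K p₁)) p₂

    tangent-foot-on-parabola : ∀ {p₁ p₂ p₃ l m n t s} → Incident (l , m , n) (p₁ , p₂ , p₃) →
      InF (s -K f t) → IsTangentAt U (l , m , n) (t , s , 1K) →
      p₃ *K s ≈K quadratic (2α *K p₃) (-K (2α *K p₁)) p₂ t
    tangent-foot-on-parabola {p₁} {p₂} {p₃} {l} {m} {n} {t} {s} L∋P s-ft∈F tangent@(_ , L∋A , _) =
      x∙y⁻¹≈ε⇒x≈y _ _ (x≉0∧x*y≈0⇒y≈0 (tangent-m≉0 s-ft∈F tangent) (begin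
        m *K (p₃ *K s -K quadratic (2α *K p₃) (-K (2α *K p₁)) p₂ t)
          ≈⟨ solve 9 (λ α l m n p₁ p₂ p₃ t s →
               m :* (p₃ :* s :- ((con (+ 2) :* α :* p₃) :* (t :* t) :+ (:- (con (+ 2) :* α :* p₁)) :* t :+ p₂))
               := (p₃ :* (l :* t :+ m :* s :+ n :* con (+ 1)) :- (l :* p₁ :+ m :* p₂ :+ n :* p₃))
                  :+ (p₁ :- t :* p₃) :* (l :+ con (+ 2) :* α :* t :* m))
               refl α l m n p₁ p₂ p₃ t s ⟩
        (p₃ *K dot (l , m , n) (t , s , 1K) -K dot (l , m , n) (p₁ , p₂ , p₃))
          +K (p₁ -K t *K p₃) *K (l +K 2α *K t *K m)
          ≈⟨ +-cong (+-cong (*-congˡ L∋A) (-‿cong L∋P)) (*-congˡ (tangent-slope s-ft∈F tangent)) ⟩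
        (p₃ *K 0K -K 0K) +K (p₁ -K t *K p₃) *K 0K
          ≈⟨ solve 2 (λ p₃ a → (p₃ :* con (+ 0) :- con (+ 0)) :+ a :* con (+ 0) := con (+ 0))
               refl p₃ (p₁ -K t *K p₃) ⟩
        0K ∎))

    foot-cases : ∀ {p₁ p₂ p₃ T} → Foot (p₁ , p₂ , p₃) T →
      (T ∼ P∞ × p₃ ≈K 0K) ⊎ footParabola (p₁ , p₂ , p₃) T
    foot-cases {p₁} {p₂} {p₃} (_ , inj₁ T∼P∞ , (l , m , n) , L≢0 , L∋P , tangent) =
      inj₁ (T∼P∞ , x≉0∧x*y≈0⇒y≈0 n≉0 (begin
        n *K p₃
          ≈⟨ solve 4 (λ n p₁ p₂ p₃ → n :* p₃ := con (+ 0) :* p₁ :+ con (+ 0) :* p₂ :+ n :* p₃) refl n p₁ p₂ p₃ ⟩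
        0K *K p₁ +K 0K *K p₂ +K n *K p₃
          ≈⟨ +-congʳ (+-cong (*-congʳ (sym l≈0)) (*-congʳ (sym m≈0))) ⟩
        l *K p₁ +K m *K p₂ +K n *K p₃
          ≈⟨ L∋P ⟩
        0K ∎))
      where
      l≈0∧m≈0 : l ≈K 0K × m ≈K 0K
      l≈0∧m≈0 = tangent-at-P∞ (IsTangentAt-resp-∼ T∼P∞ (inj₁ (≈P⇒∼ (refl , refl , refl))) tangent)
      l≈0 : l ≈K 0K
      l≈0 = proj₁ l≈0∧m≈0
      m≈0 : m ≈K 0K
      m≈0 = proj₂ l≈0∧m≈0
      n≉0 : ¬ n ≈K 0K
      n≉0 n≈0 = L≢0 (l≈0 , m≈0 , n≈0)
    foot-cases (_ , inj₂ (x , r , T∼A) , L , _ , L∋P , tangent) =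
      inj₂ (x , s , T∼A ,
            tangent-foot-on-parabola L∋P s-fx∈F (IsTangentAt-resp-∼ T∼A (affine-∈U s-fx∈F) tangent))
      where
      s : K
      s = f x +K embed r
      s-fx∈F : InF (s -K f x)
      s-fx∈F = InF-resp-≈K (solve 2 (λ fx e → e := (fx :+ e) :- fx) refl (f x) (embed r)) (InF-embed r)

    feet-contained-in-line : ∀ {p₁ p₂ p₃} → p₃ ≈K 0K →
      NonZeroPt (p₁ , p₂ , p₃) → ¬ U (p₁ , p₂ , p₃) → ContainedInLine (Foot (p₁ , p₂ , p₃))
    feet-contained-in-line {p₁} {p₂} {p₃} p₃≈0 P≢0 P∉U =
      L₀ , L₀≢0 , λ T _ foot → [ on-L₀-at-∞ , on-L₀-affine ] (foot-cases foot)
      where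
      L₀ : Pt
      L₀ = (2α *K p₁ , 0K , -K p₂)

      p₁≉0 : ¬ p₁ ≈K 0K
      p₁≉0 p₁≈0 = P∉U (inj₁ (p₂ , p₂≉0 ,
        (trans p₁≈0 (sym (zeroʳ p₂)) , sym (*-identityʳ p₂) , trans p₃≈0 (sym (zeroʳ p₂)))))
        where
        p₂≉0 : ¬ p₂ ≈K 0K
        p₂≉0 p₂≈0 = P≢0 (p₁≈0 , p₂≈0 , p₃≈0)

      L₀≢0 : NonZeroPt L₀
      L₀≢0 (2αp₁≈0 , _) = x*y≉0 (x*y≉0 2≉0 α≉0) p₁≉0 2αp₁≈0

      on-L₀-at-∞ : ∀ {T} → T ∼ P∞ × p₃ ≈K 0K → Incident L₀ T
      on-L₀-at-∞ (T∼P∞ , _) = Incident-resp-∼ L₀ (∼-sym T∼P∞)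
        (solve 3 (λ α p₁ p₂ → con (+ 2) :* α :* p₁ :* con (+ 0) :+ con (+ 0) :* con (+ 1) :+ (:- p₂) :* con (+ 0)
                              := con (+ 0)) refl α p₁ p₂)

      on-L₀-affine : ∀ {T} → footParabola (p₁ , p₂ , p₃) T → Incident L₀ T
      on-L₀-affine (t , s , T∼A , A∈) = Incident-resp-∼ L₀ (∼-sym T∼A) (begin
        2α *K p₁ *K t +K 0K *K s +K (-K p₂) *K 1K
          ≈⟨ solve 6 (λ α p₁ p₂ p₃ t s →
               con (+ 2) :* α :* p₁ :* t :+ con (+ 0) :* s :+ (:- p₂) :* con (+ 1)
               := p₃ :* (con (+ 2) :* α :* (t :* t) :- s)
                  :+ (p₃ :* s :- ((con (+ 2) :* α :* p₃) :* (t :* t) :+ (:- (con (+ 2) :* α :* p₁)) :* t :+ p₂)))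
               refl α p₁ p₂ p₃ t s ⟩
        p₃ *K (2α *K (t *K t) -K s) +K (p₃ *K s -K quadratic (2α *K p₃) (-K (2α *K p₁)) p₂ t)
          ≈⟨ +-cong (*-congʳ p₃≈0) (x≈y⇒x∙y⁻¹≈ε A∈) ⟩
        0K *K (2α *K (t *K t) -K s) +K 0K
          ≈⟨ solve 1 (λ z → con (+ 0) :* z :+ con (+ 0) := con (+ 0)) refl (2α *K (t *K t) -K s) ⟩
        0K ∎)

    feet-form-arc : ∀ {p₁ p₂ p₃} → ¬ p₃ ≈K 0K → IsArc (Foot (p₁ , p₂ , p₃))
    feet-form-arc p₃≉0 =
      IsArc-⊆ (λ foot → [ ⊥-elim ∘ p₃≉0 ∘ proj₂ , id ] (foot-cases foot))
              (parabola-isArc p₃≉0 (x*y≉0 (x*y≉0 2≉0 α≉0) p₃≉0))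

    feet-in-line-or-arc : ∀ P → NonZeroPt P → ¬ U P → ContainedInLine (Foot P) ⊎ IsArc (Foot P)
    feet-in-line-or-arc (p₁ , p₂ , p₃) P≢0 P∉U with p₃ ≟K 0K
    ... | yes p₃≈0 = inj₁ (feet-contained-in-line p₃≈0 P≢0 P∉U)
    ... | no p₃≉0 = inj₂ (feet-form-arc p₃≉0)

mainTheorem4 :
    (R : CommutativeRing 0ℓ 0ℓ) (p n : ℕ) → Prime p → p ≢ 2 →
    IsFiniteField R (p ^ n) →
    (w : CommutativeRing.Carrier R) → ¬ Plane.IsSquare R w w →
    let open Plane R w in
    (α β : K) → ¬ (α ≈K 0K) → β ≈K conj β →
    NonSquareInF ((fourK *K N α)
                   +K ((conj β -K β) *K (conj β -K β))) →
    (P : Pt) → NonZeroPt P → ¬ InU α β P →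
    ContainedInLine (IsFoot (InU α β) P) ⊎ IsArc (IsFoot (InU α β) P)
-- Odd characteristic is read off the discriminant hypothesis (which, as β ∈ GF(q), is 4N(α)).
mainTheorem4 R _ _ _ _ finiteField w w-nonsquare α β α≉0 β≈β̄ discriminant-nonsquare =
  feet-in-line-or-arc
  where
  open CommutativeRing R using (_≈_; _+_; 0#; 1#)
  open IsFiniteField finiteField using (0≉1; inverse; _≟F_)
  𝔽 : IsDecField R
  𝔽 = record { isField = record { 0≉1 = 0≉1 ; inverse = inverse } ; _≟_ = _≟F_ }
  open QuadraticExtensionField R 𝔽 w w-nonsquare
  2≉0 : ¬ 1# + 1# ≈ 0#
  2≉0 = discriminant-nonsquare⇒2≉0 β≈β̄ discriminant-nonsquare
  open ProjectivePlane.BuekenhoutMetz R 𝔽 w w-nonsquare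
         α β α≉0 (conj-fixed⇒InF 2≉0 β≈β̄) (2≉0 ∘ proj₁)
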